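{- Let $T$ be a tournament. Then $\gamma_{so}(T)\le\gamma^+(T)+1$.
   Context: A tournament is an orientation of a complete graph. For a digraph $D=(V,A)$, $N^+(v)=\{w: vw\in A\}$, $N^-(v)=\{w: wv\in A\}$. $S\subseteq V$ is out-dominating if every $v\in V\setminus S$ has an in-neighbor in $S$; $\gamma^+(D)$ is the minimum size of an out-dominating set. $S$ is a secure out-dominating set (SODS) if $S$ is out-dominating and for every $v\in V\setminus S$ there is $u\in(N^+(v)\cup N^-(v))\cap S$ such that $(S\setminus\{u\})\cup\{v\}$ is out-dominating; $\gamma_{so}(D)$ is the minimum size of an SODS. -}

module Defs where

open import Data.Nat using (ℕ; _≤_; _+_)
open import Data.Fin using (Fin)
open import Data.Fin.Subset using (Subset; _∈_; _∉_; ∣_∣; _∪_; ⁅_⁆; _─_)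
open import Data.Bool using (Bool; true; false; not)
open import Data.Product using (Σ; ∃; _×_; _,_)
open import Data.Sum using (_⊎_)
open import Relation.Binary.PropositionalEquality using (_≡_; _≢_)

Digraph : ℕ → Set
Digraph n = Fin n → Fin n → Bool

Arc : ∀ {n} → Digraph n → Fin n → Fin n → Set
Arc D u v = D u v ≡ true

IsTournament : ∀ {n} → Digraph n → Set
IsTournament {n} D =
  ((u : Fin n) → D u u ≡ false) ×
  ((u v : Fin n) → u ≢ v → D u v ≡ not (D v u))

OutDominating : ∀ {n} → Digraph n → Subset n → Set
OutDominating {n} D S =
  (v : Fin n) → v ∉ S → ∃ λ u → u ∈ S × Arc D u v

swap : ∀ {n} → Subset n → Fin n → Fin n → Subset n
swap S u v = (S ─ ⁅ u ⁆) ∪ ⁅ v ⁆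

SecureOutDominating : ∀ {n} → Digraph n → Subset n → Set
SecureOutDominating {n} D S =
  OutDominating D S ×
  ((v : Fin n) → v ∉ S →
     ∃ λ u → (Arc D v u ⊎ Arc D u v) × u ∈ S × OutDominating D (swap S u v))

IsMinSize : ∀ {n} → (Subset n → Set) → ℕ → Set
IsMinSize {n} P k =
  (∃ λ S → P S × ∣ S ∣ ≡ k) × ((S : Subset n) → P S → k ≤ ∣ S ∣)

IsOutDomNumber : ∀ {n} → Digraph n → ℕ → Set
IsOutDomNumber D k = IsMinSize (OutDominating D) k

IsSecureOutDomNumber : ∀ {n} → Digraph n → ℕ → Set
IsSecureOutDomNumber D k = IsMinSize (SecureOutDominating D) k

-- Take a minimum out-dominating set S. If S is the whole vertex set it is
-- vacuously secure. Otherwise add one vertex z ∉ S. In a tournament z is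
-- adjacent to every other vertex v, and exchanging z for v leaves S inside the
-- new set, which is therefore still out-dominating; so S ∪ {z} is secure.
module Submission where

open import Defs
open import Data.Nat using (ℕ; suc; _≤_; _+_; z≤n; s≤s)
open import Data.Nat.Properties using (≤-trans; m≤m+n; +-suc; +-monoʳ-≤; n≤1+n; module ≤-Reasoning)
open import Data.Fin using (Fin)
open import Data.Fin.Subset using (Subset; _∈_; _∉_; _⊆_; ∣_∣; _∪_; ⁅_⁆; ∁; Nonempty)
open import Data.Fin.Subset.Properties
  using (nonempty?; x∈∁p⇒x∉p; x∉p⇒x∈∁p; p⊆p∪q; x∈p∪q⁺; x∈⁅x⁆; x≢y⇒x∉⁅y⁆; x∈p∧x∉q⇒x∈p─q; ∣⁅x⁆∣≡1)
open import Data.Bool using (true; false)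
open import Data.Empty using (⊥-elim)
open import Data.Vec using ([]; _∷_)
open import Data.Product using (∃; _×_; _,_)
open import Data.Sum using (_⊎_; inj₁; inj₂)
open import Relation.Nullary using (yes; no; ¬_)
open import Relation.Binary.PropositionalEquality using (refl; sym; cong; subst; _≢_)

∣p∪q∣≤∣p∣+∣q∣ : ∀ {n} (p q : Subset n) → ∣ p ∪ q ∣ ≤ ∣ p ∣ + ∣ q ∣
∣p∪q∣≤∣p∣+∣q∣ []          []          = z≤n
∣p∪q∣≤∣p∣+∣q∣ (true ∷ p)  (false ∷ q) = s≤s (∣p∪q∣≤∣p∣+∣q∣ p q)
∣p∪q∣≤∣p∣+∣q∣ (true ∷ p)  (true ∷ q)  =
  s≤s (≤-trans (∣p∪q∣≤∣p∣+∣q∣ p q) (+-monoʳ-≤ ∣ p ∣ (n≤1+n ∣ q ∣)))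
∣p∪q∣≤∣p∣+∣q∣ (false ∷ p) (true ∷ q)  =
  subst (suc ∣ p ∪ q ∣ ≤_) (sym (+-suc ∣ p ∣ ∣ q ∣)) (s≤s (∣p∪q∣≤∣p∣+∣q∣ p q))
∣p∪q∣≤∣p∣+∣q∣ (false ∷ p) (false ∷ q) = ∣p∪q∣≤∣p∣+∣q∣ p q

OutDominating-mono : ∀ {n} (D : Digraph n) {S S′ : Subset n} →
  S ⊆ S′ → OutDominating D S → OutDominating D S′
OutDominating-mono D S⊆S′ domS v v∉S′ with domS v (λ v∈S → v∉S′ (S⊆S′ v∈S))
... | u , u∈S , u→v = u , S⊆S′ u∈S , u→v

tournament-adjacent : ∀ {n} {T : Digraph n} → IsTournament T →
  ∀ {v z} → v ≢ z → Arc T v z ⊎ Arc T z v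
tournament-adjacent {T = T} (_ , antisym) {v} {z} v≢z
  with T v z | antisym z v (λ z≡v → v≢z (sym z≡v))
... | true  | _   = inj₁ refl
... | false | z→v = inj₂ z→v

total-secure : ∀ {n} (D : Digraph n) {S : Subset n} →
  ¬ Nonempty (∁ S) → OutDominating D S → SecureOutDominating D S
total-secure D noOutsider domS =
  domS , λ v v∉S → ⊥-elim (noOutsider (v , x∉p⇒x∈∁p v∉S))

add-vertex-secure : ∀ {n} {T : Digraph n} → IsTournament T →
  {S : Subset n} {z : Fin n} → z ∉ S → OutDominating T S →
  SecureOutDominating T (S ∪ ⁅ z ⁆)
add-vertex-secure {T = T} tour {S} {z} z∉S domS =
  OutDominating-mono T (p⊆p∪q ⁅ z ⁆) domS , secure
  where
  z∈S′ : z ∈ S ∪ ⁅ z ⁆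
  z∈S′ = x∈p∪q⁺ (inj₂ (x∈⁅x⁆ z))

  S⊆swap : ∀ v → S ⊆ swap (S ∪ ⁅ z ⁆) z v
  S⊆swap v x∈S = x∈p∪q⁺ (inj₁ (x∈p∧x∉q⇒x∈p─q (p⊆p∪q ⁅ z ⁆ x∈S)
    (x≢y⇒x∉⁅y⁆ (λ x≡z → z∉S (subst (_∈ S) x≡z x∈S)))))

  secure : ∀ v → v ∉ S ∪ ⁅ z ⁆ → ∃ λ u → (Arc T v u ⊎ Arc T u v) ×
    u ∈ S ∪ ⁅ z ⁆ × OutDominating T (swap (S ∪ ⁅ z ⁆) u v)
  secure v v∉S′ =
    z , tournament-adjacent tour (λ v≡z → v∉S′ (subst (_∈ _) (sym v≡z) z∈S′)) ,
    z∈S′ , OutDominating-mono T (S⊆swap v) domS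

theorem4p11 : (n : ℕ) (T : Digraph n) → IsTournament T →
    (g gso : ℕ) → IsOutDomNumber T g → IsSecureOutDomNumber T gso →
    gso ≤ g + 1
theorem4p11 n T tour g gso ((S , domS , refl) , _) (_ , gso-min)
  with nonempty? (∁ S)
... | no noOutsider = ≤-trans (gso-min S (total-secure T noOutsider domS)) (m≤m+n ∣ S ∣ 1)
... | yes (z , z∈∁S) = begin
  gso                 ≤⟨ gso-min _ (add-vertex-secure tour (x∈∁p⇒x∉p z∈∁S) domS) ⟩
  ∣ S ∪ ⁅ z ⁆ ∣       ≤⟨ ∣p∪q∣≤∣p∣+∣q∣ S ⁅ z ⁆ ⟩
  ∣ S ∣ + ∣ ⁅ z ⁆ ∣   ≡⟨ cong (∣ S ∣ +_) (∣⁅x⁆∣≡1 z) ⟩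
  ∣ S ∣ + 1           ∎
  where open ≤-Reasoning
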